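{- Let $\Pi$ be a GSP of an SF instance $I=(A,\succ,c)$ and let $C=(a_{i_1}\ a_{i_2}\ \dots\ a_{i_k})\in\Pi$ be a cycle of odd length $k\ge3$. Fix any $j$ with $1\le j\le k$, with indices of the $a_{i_\cdot}$ taken modulo $k$. Then: (i) $\Pi'=(\Pi\setminus\{C\})\cup\{(a_{i_{j+1}}\ a_{i_{j+2}}),(a_{i_{j+3}}\ a_{i_{j+4}}),\dots,(a_{i_{j-2}}\ a_{i_{j-1}})\}$ is a GSP (is stable) in the instance $I'=(A,\succ,c')$ with $c'_l=c_l$ for all $a_l\in A\setminus\{a_{i_j}\}$ and $c'_{i_j}=c_{i_j}-1$; (ii) $\Pi''=(\Pi\setminus\{C\})\cup\{(a_{i_j}\ a_{i_{j+1}}),(a_{i_{j+2}}\ a_{i_{j+3}}),\dots,(a_{i_{j-1}}\ a_{i_j})\}$ is a GSP (is stable) in the instance $I''=(A,\succ,c'')$ with $c''_l=c_l$ for all $a_l\in A\setminus\{a_{i_j}\}$ and $c''_{i_j}=c_{i_j}+1$.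
   Context: A Stable Fixtures (SF) instance is $I=(A,\succ,c)$ where $A=\{a_1,\dots,a_n\}$ is a finite set of $n$ agents; each agent $a_i$ has a strict linear order $\succ_i$ over $A\setminus\{a_i\}$ (complete preference list), with the convention that every agent ranks itself last ($a_j\succ_i a_i$ for all $j\neq i$); $a\succeq_i b$ means $a\succ_i b$ or $a=b$. Each agent has an integer capacity $c_i$ with $1\le c_i<n$ (in the modified instance $I'$ a capacity may become 0, in which case the agent lies in no cycle; the GSP definition below applies verbatim). A cyclic permutation of a nonempty set $A_r\subseteq A$ is a permutation $\Pi_r$ of $A_r$ consisting of a single cycle of length $|A_r|$ (length 1: a fixed point $(a_i)$; length 2: a transposition $(a_i\ a_j)$). Two cyclic permutations are distinct if some element is mapped to different elements by them. A GSP (generalised stable partition) of $I$ is a finite collection $\Pi=\{\Pi_1,\dots,\Pi_k\}$ of cyclic permutations $\Pi_r$ of sets $A_r\subseteq A$, pairwise distinct except that fixed points may be repeated, such that: (F1) for every $r$ and every $a_j\in A_r$, $\Pi_r(a_j)\succeq_j\Pi_r^{ -1}(a_j)$; (F2) there are no distinct $a_i,a_j\in A$ with the transposition $(a_i\ a_j)\notin\Pi$ such that $a_j\succ_i\Pi_r^{ -1}(a_i)$ and $a_i\succ_j\Pi_s^{ -1}(a_j)$ for some $\Pi_r,\Pi_s\in\Pi$ with $a_i\in A_r$, $a_j\in A_s$; (F3) for every $a_i\in A$, the number of indices $r$ with $a_i\in A_r$ equals $c_i$; (F4) for all distinct $a_i,a_j\in A$, $|\{s:\Pi_s(a_i)=a_j\}|+|\{s:\Pi_s(a_j)=a_i\}|\le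 2$. -}

module Defs where

open import Data.Nat using (ℕ; zero; suc; _+_; _∸_; _≤_; _<_)
open import Data.Fin using (Fin; toℕ) renaming (_≟_ to _≟ᶠ_)
open import Data.List using (List; []; _∷_; _++_; length; filter; lookup; drop; take; zipWith; [_])
open import Data.List.Relation.Unary.Any using (Any)
open import Data.List.Relation.Unary.All using (All)
open import Data.List.Relation.Unary.Unique.Propositional using (Unique)
open import Data.Product using (_×_; _,_; ∃; ∃-syntax; Σ)
open import Data.Product.Properties using (≡-dec)
import Data.Bool
open import Data.Sum using (_⊎_)
open import Function.Bundles using (_⇔_)
open import Relation.Nullary using (¬_; does)
open import Relation.Binary.PropositionalEquality using (_≡_; _≢_)
open import Relation.Binary.Structures using (IsStrictTotalOrder)
import Data.List.Membership.DecPropositional as DecMem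
open import Data.List.Membership.Propositional using (_∈_)

record Preferences (n : ℕ) : Set₁ where
  field
    _≻[_]_   : Fin n → Fin n → Fin n → Set
    isSTO    : ∀ i → IsStrictTotalOrder _≡_ (λ a b → a ≻[ i ] b)
    selfLast : ∀ i j → j ≢ i → j ≻[ i ] i

  _⪰[_]_ : Fin n → Fin n → Fin n → Set
  a ⪰[ i ] b = (a ≻[ i ] b) ⊎ (a ≡ b)


ValidCapacity : (n : ℕ) → (Fin n → ℕ) → Set
ValidCapacity n c = ∀ i → 1 ≤ c i × c i < n

-- A cycle (a₁ a₂ … a_k) is represented by the list
-- a₁ ∷ a₂ ∷ … ∷ a_k ∷ [] (distinct entries, nonempty); it maps a_m to
-- a_{m+1} and a_k to a₁.  A fixed point (a) is the list [ a ].

Cycle : ℕ → Set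
Cycle n = List (Fin n)

pairs : ∀ {n} → Cycle n → List (Fin n × Fin n)
pairs []       = []
pairs (x ∷ xs) = zipWith _,_ (x ∷ xs) (xs ++ [ x ])

Maps : ∀ {n} → Cycle n → Fin n → Fin n → Set
Maps C a b = (a , b) ∈ pairs C

IsCyclicPerm : ∀ {n} → Cycle n → Set
IsCyclicPerm C = (C ≢ []) × Unique C

-- two cyclic permutations are equal (not distinct) iff they map every
-- element to the same element (same graph)
SameCycle : ∀ {n} → Cycle n → Cycle n → Set
SameCycle {n} C D = ∀ (a b : Fin n) → Maps C a b ⇔ Maps D a b

transp : ∀ {n} → Fin n → Fin n → Cycle n
transp a b = a ∷ b ∷ []

-- a collection of cyclic permutations (a multiset, given as a list)
Partition : ℕ → Set
Partition n = List (Cycle n)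

module _ {n : ℕ} where
  open DecMem (_≟ᶠ_ {n}) using () renaming (_∈?_ to _∈ᶠ?_)
  open DecMem (≡-dec (_≟ᶠ_ {n}) (_≟ᶠ_ {n})) using () renaming (_∈?_ to _∈ᵖ?_)

  occ : Fin n → Partition n → ℕ
  occ a Π = length (filter (λ C → a ∈ᶠ? C) Π)

  mapCount : Fin n → Fin n → Partition n → ℕ
  mapCount a b Π = length (filter (λ C → (a , b) ∈ᵖ? pairs C) Π)

module _ {n : ℕ} (P : Preferences n) where
 open Preferences P

 record IsGSP (c : Fin n → ℕ) (Π : Partition n) : Set where
  field
    cyclic   : All IsCyclicPerm Π
    -- pairwise distinct, except that fixed points may be repeated
    distinct : ∀ (r s : Fin (length Π)) → r ≢ s → 2 ≤ length (lookup Π r) →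
               ¬ SameCycle (lookup Π r) (lookup Π s)
    F1 : ∀ C → C ∈ Π → ∀ a b d → Maps C a b → Maps C d a → b ⪰[ a ] d
    -- (F2) no blocking pair
    F2 : ∀ (i j : Fin n) → i ≢ j → ¬ Any (SameCycle (transp i j)) Π →
         ¬ ( (∃[ C ] ∃[ d ] (C ∈ Π × Maps C d i × (j ≻[ i ] d)))
           × (∃[ D ] ∃[ e ] (D ∈ Π × Maps D e j × (i ≻[ j ] e))) )
    F3 : ∀ a → occ a Π ≡ c a
    F4 : ∀ a b → a ≢ b → mapCount a b Π + mapCount b a Π ≤ 2

adjustCap : ∀ {n} → (Fin n → ℕ) → Fin n → (ℕ → ℕ) → Fin n → ℕ
adjustCap c a f l with does (l ≟ᶠ a)
... | Data.Bool.true  = f (c l)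
... | Data.Bool.false = c l

-- rotate the cycle so that it starts at position j (0-based):
-- (a_{i_j} a_{i_{j+1}} … a_{i_{j-1}})
rotateAt : ∀ {n} (C : Cycle n) → Fin (length C) → List (Fin n)
rotateAt C j = drop (toℕ j) C ++ take (toℕ j) C

pairUp : ∀ {n} → List (Fin n) → Partition n
pairUp (x ∷ y ∷ r) = transp x y ∷ pairUp r
pairUp _           = []

-- Rotate the odd cycle C to the front of Π so that it reads B = x₀ ∷ t with x₀ = a_{i_j}; this
-- does not affect being a GSP. Stability forces no other cycle of Π to use an edge x → y of B, in
-- either direction: the reverse y → x would make {x, y} a blocking pair or violate (F4), and a
-- cycle sharing x → y would, by stability at the agent where it leaves B, share the preceding
-- edge as well, hence all of B. So the transpositions along alternate edges of B are pairwise
-- distinct and use fresh edges, which preserves (F4); (F1) is trivial for them; and every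
-- agent's new predecessor is at least as good as an old one, so no blocking pair appears.
-- As |t| is even, pairing up t leaves x₀ out, while pairing up x₀ ∷ t ++ [ x₀ ] puts x₀ into
-- two transpositions: the capacity of x₀ changes by ∓1.

module Submission where

open import Defs
open import Data.Nat using (ℕ; suc; _+_; _∸_; _%_; _≤_; z≤n; s≤s)
open import Data.Nat.Properties
  using (≤-refl; ≤-trans; ≤-reflexive; ≤-pred; n≤1+n; +-mono-≤; +-comm; +-identityʳ; 1+n≰n; module ≤-Reasoning)
open import Data.Fin using (Fin; toℕ) renaming (_≟_ to _≟ᶠ_)
import Data.Fin as Fin
open import Data.Fin.Properties using (suc-injective)
open import Data.List using (List; []; _∷_; [_]; _++_; length; lookup; removeAt; drop; take; zipWith; filter)
open import Data.List.Properties
  using (length-++; ++-identityʳ; take++drop≡id; filter-accept; filter-reject; filter-++; filter-some; filter-none)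
open import Data.List.Relation.Unary.Any using (Any; here; there; index; any?)
open import Data.List.Relation.Unary.Any.Properties using (lookup-index)
import Data.List.Relation.Unary.Any.Properties as Any
open import Data.List.Relation.Unary.All as All using (All; []; _∷_)
import Data.List.Relation.Unary.All.Properties as All
open import Data.List.Relation.Unary.AllPairs as AllPairs using (AllPairs; []; _∷_)
import Data.List.Relation.Unary.AllPairs.Properties as AllPairs
open import Data.List.Relation.Unary.Linked as Linked using (Linked; []; [-]; _∷_)
open import Data.List.Relation.Unary.Unique.Propositional using (Unique)
open import Data.List.Membership.Propositional using (_∈_; _∉_; find; lose)
open import Data.List.Membership.Propositional.Properties using (∈-++⁻; ∈-lookup)
import Data.List.Membership.DecPropositional as DecMembership
open import Data.List.Relation.Binary.Permutation.Propositional
  using (_↭_; ↭-refl; ↭-reflexive; ↭-sym; ↭-trans; ↭-prep; ↭-swap; ↭⇒↭ₛ)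
open import Data.List.Relation.Binary.Permutation.Propositional.Properties
  using (All-resp-↭; Any-resp-↭; ∈-resp-↭; ++-comm; ↭-length)
import Data.List.Relation.Binary.Permutation.Setoid.Properties as ↭ₛ
open import Data.Product using (_×_; _,_; ∃-syntax; proj₁; proj₂)
open import Data.Product.Properties using (≡-dec)
open import Data.Sum using (_⊎_; inj₁; inj₂)
import Data.Sum
open import Data.Empty using (⊥; ⊥-elim)
open import Function using (_∘_; id; case_of_)
open import Function.Bundles using (Equivalence; mk⇔)
open import Function.Construct.Symmetry using (⇔-sym)
open import Function.Construct.Composition using (_⇔-∘_)
open import Level using (0ℓ)
open import Relation.Nullary using (¬_; Dec; yes; no)
open import Relation.Unary using (Pred; Decidable)
open import Relation.Binary.Definitions using (Symmetric; tri<; tri≈; tri>)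
open import Relation.Binary.Structures using (IsStrictTotalOrder)
open import Relation.Binary.Construct.Closure.ReflexiveTransitive as Star using (Star; ε; _◅_; _◅◅_)
open import Relation.Binary.PropositionalEquality as ≡ using (_≡_; _≢_; refl; sym; trans; cong; cong₂; subst)
open import Relation.Binary.PropositionalEquality.Properties using (module ≡-Reasoning)

module _ {A : Set} {P : Pred A 0ℓ} (P? : Decidable P) where

  count : List A → ℕ
  count xs = length (filter P? xs)

  count-accept : ∀ {x} xs → P x → count (x ∷ xs) ≡ suc (count xs)
  count-accept xs px = cong length (filter-accept P? px)

  count-reject : ∀ {x} xs → ¬ P x → count (x ∷ xs) ≡ count xs
  count-reject xs ¬px = cong length (filter-reject P? ¬px)

  count-++ : ∀ xs ys → count (xs ++ ys) ≡ count xs + count ys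
  count-++ xs ys = trans (cong length (filter-++ P? xs ys)) (length-++ (filter P? xs))

  count-↭ : ∀ {xs ys} → xs ↭ ys → count xs ≡ count ys
  count-↭ p = ↭ₛ.xs↭ys⇒|xs|≡|ys| (≡.setoid A) (↭ₛ.filter⁺ (≡.setoid A) P? (≡.resp P) (↭⇒↭ₛ p))

  count-≤-∷ : ∀ x xs → count xs ≤ count (x ∷ xs)
  count-≤-∷ x xs with P? x
  ... | yes px = n≤1+n _
  ... | no ¬px = ≤-refl

  count-head-cong : ∀ {x y} xs → (P x → P y) → (P y → P x) → count (x ∷ xs) ≡ count (y ∷ xs)
  count-head-cong {x} xs x⇒y y⇒x with P? x
  ... | yes px = sym (count-accept xs (x⇒y px))
  ... | no ¬px = sym (count-reject xs (¬px ∘ y⇒x))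

  count≥1 : ∀ {x xs} → x ∈ xs → P x → 1 ≤ count xs
  count≥1 x∈xs px = filter-some P? (lose x∈xs px)

  count≥2-∷ : ∀ {x y} xs → P x → y ∈ xs → P y → 2 ≤ count (x ∷ xs)
  count≥2-∷ xs px y∈xs py = ≤-trans (s≤s (count≥1 y∈xs py)) (≤-reflexive (sym (count-accept xs px)))

  count≥2 : ∀ {x y xs} → x ∈ xs → y ∈ xs → x ≢ y → P x → P y → 2 ≤ count xs
  count≥2 (here refl) (here refl) x≢y _ _ = ⊥-elim (x≢y refl)
  count≥2 {xs = _ ∷ xs} (here refl) (there y∈xs) _ px py = count≥2-∷ xs px y∈xs py
  count≥2 {xs = _ ∷ xs} (there x∈xs) (here refl) _ px py = count≥2-∷ xs py x∈xs px
  count≥2 {xs = z ∷ xs} (there x∈xs) (there y∈xs) x≢y px py =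
    ≤-trans (count≥2 x∈xs y∈xs x≢y px py) (count-≤-∷ z xs)

  count≡0 : ∀ xs → (∀ {x} → x ∈ xs → ¬ P x) → count xs ≡ 0
  count≡0 xs none = cong length (filter-none P? (All.tabulate none))

  count≤1 : ∀ {S : A → A → Set} {xs} → AllPairs S xs → (∀ {x y} → P x → P y → S x y → ⊥) → count xs ≤ 1
  count≤1 [] _ = z≤n
  count≤1 {xs = x ∷ xs} (Sx ∷ Sxs) excl with P? x
  ... | yes px = ≤-reflexive (cong suc (count≡0 xs (λ y∈xs py → excl px py (All.lookup Sx y∈xs))))
  ... | no ¬px = count≤1 Sxs excl

module _ {A : Set} where

  -- pairs (x ∷ xs) is pathPairs x xs x by definition
  pathPairs : A → List A → A → List (A × A)
  pathPairs u l z = zipWith _,_ (u ∷ l) (l ++ [ z ])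

  pathPairs-++ : ∀ u l v m z → pathPairs u (l ++ v ∷ m) z ≡ pathPairs u l v ++ pathPairs v m z
  pathPairs-++ u []      v m z = refl
  pathPairs-++ u (w ∷ l) v m z = cong ((u , w) ∷_) (pathPairs-++ w l v m z)

  pathPairs⇒∈ˡ : ∀ {u z l a b} → (a , b) ∈ pathPairs u l z → a ∈ u ∷ l
  pathPairs⇒∈ˡ {l = []}    (here refl) = here refl
  pathPairs⇒∈ˡ {l = w ∷ l} (here refl) = here refl
  pathPairs⇒∈ˡ {l = w ∷ l} (there e)   = there (pathPairs⇒∈ˡ e)

  pathPairs⇒∈ʳ : ∀ {u z l a b} → (a , b) ∈ pathPairs u l z → b ∈ l ++ [ z ]
  pathPairs⇒∈ʳ {l = []}    (here refl) = here refl
  pathPairs⇒∈ʳ {l = w ∷ l} (here refl) = here refl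
  pathPairs⇒∈ʳ {l = w ∷ l} (there e)   = there (pathPairs⇒∈ʳ e)

  pathPairs-functional : ∀ {u z l a b b′} → Unique (u ∷ l) →
                         (a , b) ∈ pathPairs u l z → (a , b′) ∈ pathPairs u l z → b ≡ b′
  pathPairs-functional {l = []}    _ (here refl) (here refl) = refl
  pathPairs-functional {l = w ∷ l} _ (here refl) (here refl) = refl
  pathPairs-functional {l = w ∷ l} (u∉ ∷ _) (here refl) (there e) =
    ⊥-elim (All.lookup u∉ (pathPairs⇒∈ˡ e) refl)
  pathPairs-functional {l = w ∷ l} (u∉ ∷ _) (there e) (here refl) =
    ⊥-elim (All.lookup u∉ (pathPairs⇒∈ˡ e) refl)
  pathPairs-functional {l = w ∷ l} (_ ∷ uniq) (there e) (there e′) = pathPairs-functional uniq e e′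

  pathPairs-successor : ∀ {u z l a} → a ∈ u ∷ l → ∃[ b ] (a , b) ∈ pathPairs u l z
  pathPairs-successor {z = z} {l = []} (here refl) = z , here refl
  pathPairs-successor {l = w ∷ l} (here refl) = w , here refl
  pathPairs-successor {l = w ∷ l} (there a∈) with pathPairs-successor a∈
  ... | b , e = b , there e

  pathPairs-predecessor : ∀ {u z l b} → b ∈ l ++ [ z ] → ∃[ a ] (a , b) ∈ pathPairs u l z
  pathPairs-predecessor {u} {l = []} (here refl) = u , here refl
  pathPairs-predecessor {u} {l = w ∷ l} (here refl) = u , here refl
  pathPairs-predecessor {l = w ∷ l} (there b∈) with pathPairs-predecessor b∈
  ... | a , e = a , there e

  pathPairs-reach-end : ∀ {u z l a} → a ∈ u ∷ l → Star (λ x y → (x , y) ∈ pathPairs u l z) a z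
  pathPairs-reach-end {l = []}    (here refl) = here refl ◅ ε
  pathPairs-reach-end {l = w ∷ l} (here refl) = here refl ◅ Star.map there (pathPairs-reach-end (here refl))
  pathPairs-reach-end {l = w ∷ l} (there a∈)  = Star.map there (pathPairs-reach-end a∈)

  pathPairs-reach-from-start : ∀ {u z l b} → b ∈ u ∷ l → Star (λ x y → (x , y) ∈ pathPairs u l z) u b
  pathPairs-reach-from-start             (here refl) = ε
  pathPairs-reach-from-start {l = w ∷ l} (there b∈)  = here refl ◅ Star.map there (pathPairs-reach-from-start b∈)

  pathPairs-linked : ∀ {u z} l → Linked (λ x y → (x , y) ∈ pathPairs u l z) (u ∷ l ++ [ z ])
  pathPairs-linked []      = here refl ∷ [-]
  pathPairs-linked (w ∷ l) = here refl ∷ Linked.map there (pathPairs-linked l)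

module _ {n : ℕ} where

  private
    ∈-rotate : ∀ {a x : Fin n} {xs} → a ∈ x ∷ xs → a ∈ xs ++ [ x ]
    ∈-rotate {xs = xs} a∈ = ∈-resp-↭ (++-comm [ _ ] xs) a∈

  Maps⇒∈ˡ : ∀ {C : Cycle n} {a b} → Maps C a b → a ∈ C
  Maps⇒∈ˡ {x ∷ xs} = pathPairs⇒∈ˡ

  Maps⇒∈ʳ : ∀ {C : Cycle n} {a b} → Maps C a b → b ∈ C
  Maps⇒∈ʳ {x ∷ xs} e = ∈-resp-↭ (++-comm xs [ x ]) (pathPairs⇒∈ʳ e)

  Maps-functional : ∀ {C : Cycle n} {a b b′} → Unique C → Maps C a b → Maps C a b′ → b ≡ b′
  Maps-functional {x ∷ xs} = pathPairs-functional

  successor : ∀ {C : Cycle n} {a} → a ∈ C → ∃[ b ] Maps C a b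
  successor {x ∷ xs} = pathPairs-successor

  predecessor : ∀ {C : Cycle n} {b} → b ∈ C → ∃[ a ] Maps C a b
  predecessor {x ∷ xs} b∈ = pathPairs-predecessor (∈-rotate b∈)

  Maps-connected : ∀ {C : Cycle n} {a b} → a ∈ C → b ∈ C → Star (Maps C) a b
  Maps-connected {x ∷ xs} a∈ b∈ = pathPairs-reach-end a∈ ◅◅ pathPairs-reach-from-start b∈

  Maps-rotate : ∀ xs ys {a b : Fin n} → Maps (xs ++ ys) a b → Maps (ys ++ xs) a b
  Maps-rotate [] ys e rewrite ++-identityʳ ys = e
  Maps-rotate (x ∷ xs) [] e rewrite ++-identityʳ xs = e
  Maps-rotate (x ∷ xs) (y ∷ ys) e
    rewrite pathPairs-++ x xs y ys x | pathPairs-++ y ys x xs y =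
    ∈-resp-↭ (++-comm (pathPairs x xs y) (pathPairs y ys x)) e

  SameCycle-rotate : ∀ (xs ys : Cycle n) → SameCycle (xs ++ ys) (ys ++ xs)
  SameCycle-rotate xs ys a b = mk⇔ (Maps-rotate xs ys) (Maps-rotate ys xs)

  Maps-propagate : ∀ {C : Cycle n} (Q : Fin n → Set) → (∀ {a b} → Maps C a b → Q a → Q b) →
                   ∀ {a b} → a ∈ C → b ∈ C → Q a → Q b
  Maps-propagate Q step a∈ b∈ =
    Star.fold (λ a b → Q a → Q b) (λ e f → f ∘ step e) id (Maps-connected a∈ b∈)

  Maps-backpropagate : ∀ {C : Cycle n} (Q : Fin n → Set) → (∀ {a b} → Maps C a b → Q b → Q a) →
                       ∀ {a b} → a ∈ C → b ∈ C → Q b → Q a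
  Maps-backpropagate Q step a∈ b∈ =
    Star.fold (λ a b → Q b → Q a) (λ e f → step e ∘ f) id (Maps-connected a∈ b∈)

  private
    pigeonhole : ∀ {x y c₀ c₁ c₂ : Fin n} → c₀ ≢ c₁ → c₀ ≢ c₂ → c₁ ≢ c₂ →
                 c₀ ≡ x ⊎ c₀ ≡ y → c₁ ≡ x ⊎ c₁ ≡ y → c₂ ≡ x ⊎ c₂ ≡ y → ⊥
    pigeonhole ne₀₁ _ _ (inj₁ refl) (inj₁ refl) _ = ne₀₁ refl
    pigeonhole ne₀₁ _ _ (inj₂ refl) (inj₂ refl) _ = ne₀₁ refl
    pigeonhole _ ne₀₂ _ (inj₁ refl) _ (inj₁ refl) = ne₀₂ refl
    pigeonhole _ ne₀₂ _ (inj₂ refl) _ (inj₂ refl) = ne₀₂ refl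
    pigeonhole _ _ ne₁₂ _ (inj₁ refl) (inj₁ refl) = ne₁₂ refl
    pigeonhole _ _ ne₁₂ _ (inj₂ refl) (inj₂ refl) = ne₁₂ refl

  no-2-cycle : ∀ {C : Cycle n} {x y} → Unique C → 3 ≤ length C → Maps C x y → Maps C y x → ⊥
  no-2-cycle {_ ∷ []} _ (s≤s ())
  no-2-cycle {_ ∷ _ ∷ []} _ (s≤s (s≤s ()))
  no-2-cycle {C@(c₀ ∷ c₁ ∷ c₂ ∷ _)} {x} {y} uniq@((ne₀₁ ∷ ne₀₂ ∷ _) ∷ (ne₁₂ ∷ _) ∷ _) _ xy yx =
    pigeonhole ne₀₁ ne₀₂ ne₁₂ (in-xy (here refl)) (in-xy (there (here refl))) (in-xy (there (there (here refl))))
    where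
    closed : ∀ {a b} → Maps C a b → a ≡ x ⊎ a ≡ y → b ≡ x ⊎ b ≡ y
    closed ab (inj₁ refl) = inj₂ (Maps-functional uniq ab xy)
    closed ab (inj₂ refl) = inj₁ (Maps-functional uniq ab yx)
    in-xy : ∀ {b} → b ∈ C → b ≡ x ⊎ b ≡ y
    in-xy b∈ = Maps-propagate (λ b → b ≡ x ⊎ b ≡ y) closed (Maps⇒∈ˡ xy) b∈ (inj₁ refl)

module _ {A : Set} where

  drop-lookup : ∀ (xs : List A) i → drop (toℕ i) xs ≡ lookup xs i ∷ drop (suc (toℕ i)) xs
  drop-lookup (x ∷ xs) Fin.zero    = refl
  drop-lookup (x ∷ xs) (Fin.suc i) = drop-lookup xs i

module _ {n : ℕ} (C : Cycle n) (j : Fin (length C)) where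

  rotateAt-lookup : rotateAt C j ≡ lookup C j ∷ drop (suc (toℕ j)) C ++ take (toℕ j) C
  rotateAt-lookup = cong (_++ take (toℕ j) C) (drop-lookup C j)

  rotateAt-↭ : rotateAt C j ↭ C
  rotateAt-↭ = ↭-trans (++-comm (drop (toℕ j) C) (take (toℕ j) C)) (↭-reflexive (take++drop≡id (toℕ j) C))

  SameCycle-rotateAt : SameCycle C (rotateAt C j)
  SameCycle-rotateAt = subst (λ D → SameCycle D (rotateAt C j)) (take++drop≡id (toℕ j) C)
                             (SameCycle-rotate (take (toℕ j) C) (drop (toℕ j) C))

module _ {A : Set} {R : A → A → Set} where

  AllPairs⇒lookup : Symmetric R → ∀ {xs} → AllPairs R xs → ∀ r s → r ≢ s → R (lookup xs r) (lookup xs s)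
  AllPairs⇒lookup R-sym {_ ∷ _} _ Fin.zero Fin.zero r≢s = ⊥-elim (r≢s refl)
  AllPairs⇒lookup R-sym {_ ∷ _} (Rx ∷ _) Fin.zero (Fin.suc s) _ = All.lookup Rx (∈-lookup s)
  AllPairs⇒lookup R-sym {_ ∷ _} (Rx ∷ _) (Fin.suc r) Fin.zero _ = R-sym (All.lookup Rx (∈-lookup r))
  AllPairs⇒lookup R-sym {_ ∷ _} (_ ∷ Rxs) (Fin.suc r) (Fin.suc s) r≢s =
    AllPairs⇒lookup R-sym Rxs r s (r≢s ∘ cong Fin.suc)

  lookup⇒AllPairs : ∀ {xs} → (∀ r s → r ≢ s → R (lookup xs r) (lookup xs s)) → AllPairs R xs
  lookup⇒AllPairs {[]} _ = []
  lookup⇒AllPairs {x ∷ xs} R-lookup =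
    All.tabulate (λ y∈xs → subst (R x) (sym (lookup-index y∈xs)) (R-lookup Fin.zero (Fin.suc (index y∈xs)) λ ()))
    ∷ lookup⇒AllPairs (λ r s r≢s → R-lookup (Fin.suc r) (Fin.suc s) (r≢s ∘ suc-injective))

module _ {A : Set} where

  lookup∷removeAt-↭ : ∀ (xs : List A) i → lookup xs i ∷ removeAt xs i ↭ xs
  lookup∷removeAt-↭ (x ∷ xs) Fin.zero    = ↭-refl
  lookup∷removeAt-↭ (x ∷ xs) (Fin.suc i) = ↭-trans (↭-swap _ x ↭-refl) (↭-prep x (lookup∷removeAt-↭ xs i))

  ≢[]-resp-length : ∀ {xs ys : List A} → xs ≢ [] → length xs ≡ length ys → ys ≢ []
  ≢[]-resp-length {[]}    xs≢[] _ _ = xs≢[] refl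
  ≢[]-resp-length {_ ∷ _} _ () refl

module _ {n : ℕ} where

  -- occ a and mapCount u v count with exactly these deciders
  _∈?_ : (a : Fin n) (C : Cycle n) → Dec (a ∈ C)
  _∈?_ = DecMembership._∈?_ _≟ᶠ_

  edge? : (u v : Fin n) (C : Cycle n) → Dec (Maps C u v)
  edge? u v C = DecMembership._∈?_ (≡-dec _≟ᶠ_ _≟ᶠ_) (u , v) (pairs C)

  SameCycle-sym : ∀ {C D : Cycle n} → SameCycle C D → SameCycle D C
  SameCycle-sym C~D a b = ⇔-sym (C~D a b)

  SameCycle-trans : ∀ {C D E : Cycle n} → SameCycle C D → SameCycle D E → SameCycle C E
  SameCycle-trans C~D D~E a b = D~E a b ⇔-∘ C~D a b

  SameCycle-∈ : ∀ {C D : Cycle n} {a} → SameCycle C D → a ∈ C → a ∈ D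
  SameCycle-∈ {a = a} C~D a∈C = let b , ab = successor a∈C in Maps⇒∈ˡ (Equivalence.to (C~D a b) ab)

  record Distinct (C D : Cycle n) : Set where
    constructor distinguish
    field
      distinctˡ : 2 ≤ length C → ¬ SameCycle C D
      distinctʳ : 2 ≤ length D → ¬ SameCycle D C

  Distinct-sym : Symmetric Distinct
  Distinct-sym (distinguish C≉D D≉C) = distinguish D≉C C≉D

  Distinct-respects : ∀ {C D E : Cycle n} → SameCycle C D → length C ≡ length D → Distinct C E → Distinct D E
  Distinct-respects {C} {D} {E} C~D |C|≡|D| (distinguish C≉E E≉C) = distinguish
    (λ 2≤|D| D~E → C≉E (subst (2 ≤_) (sym |C|≡|D|) 2≤|D|) (SameCycle-trans {C} {D} {E} C~D D~E))
    (λ 2≤|E| E~D → E≉C 2≤|E| (SameCycle-trans {E} {D} {C} E~D (SameCycle-sym {C} {D} C~D)))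

module _ {n : ℕ} (Pr : Preferences n) where
  open Preferences Pr

  -- one half of a blocking pair in (F2)
  Accepts : Partition n → Fin n → Fin n → Set
  Accepts Π i j = ∃[ C ] ∃[ d ] (C ∈ Π × Maps C d i × (j ≻[ i ] d))

  ≻-⪰-trans : ∀ {i j d d′} → j ≻[ i ] d → d ⪰[ i ] d′ → j ≻[ i ] d′
  ≻-⪰-trans {i} j≻d (inj₁ d≻d′) = IsStrictTotalOrder.trans (isSTO i) j≻d d≻d′
  ≻-⪰-trans     j≻d (inj₂ refl) = j≻d

  Distinct⇒distinct : ∀ {Π : Partition n} → AllPairs Distinct Π →
                      ∀ r s → r ≢ s → 2 ≤ length (lookup Π r) → ¬ SameCycle (lookup Π r) (lookup Π s)
  Distinct⇒distinct ds r s r≢s = Distinct.distinctˡ (AllPairs⇒lookup Distinct-sym ds r s r≢s)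

  IsGSP⇒Distinct : ∀ {c Π} → IsGSP Pr c Π → AllPairs Distinct Π
  IsGSP⇒Distinct {Π = Π} G = lookup⇒AllPairs λ r s r≢s → distinguish (distinct r s r≢s) (distinct s r (r≢s ∘ sym))
    where open IsGSP G

  IsGSP-↭ : ∀ {c Π Π′} → Π ↭ Π′ → IsGSP Pr c Π → IsGSP Pr c Π′
  IsGSP-↭ {c} {Π} {Π′} Π↭Π′ G = record
    { cyclic   = All-resp-↭ Π↭Π′ cyclic
    ; distinct = Distinct⇒distinct (↭ₛ.AllPairs-resp-↭ (≡.setoid (Cycle n)) Distinct-sym (≡.resp₂ Distinct)
                                                       (↭⇒↭ₛ Π↭Π′) (IsGSP⇒Distinct G))
    ; F1       = λ C C∈Π′ → F1 C (∈-resp-↭ (↭-sym Π↭Π′) C∈Π′)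
    ; F2       = λ i j i≢j no-ij (i⇝j , j⇝i) →
                   F2 i j i≢j (no-ij ∘ Any-resp-↭ Π↭Π′) (back {i} {j} i⇝j , back {j} {i} j⇝i)
    ; F3       = λ a → trans (sym (count-↭ (a ∈?_) Π↭Π′)) (F3 a)
    ; F4       = λ a b a≢b → subst (_≤ 2) (cong₂ _+_ (count-↭ (edge? a b) Π↭Π′)
                                                     (count-↭ (edge? b a) Π↭Π′)) (F4 a b a≢b)
    }
    where
    open IsGSP G
    back : ∀ {i j} → Accepts Π′ i j → Accepts Π i j
    back (C , d , C∈Π′ , di , j≻d) = C , d , ∈-resp-↭ (↭-sym Π↭Π′) C∈Π′ , di , j≻d

  IsGSP-replaceHead : ∀ {c C B R} → SameCycle C B → length C ≡ length B → Unique B →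
                      IsGSP Pr c (C ∷ R) → IsGSP Pr c (B ∷ R)
  IsGSP-replaceHead {c} {C} {B} {R} C~B |C|≡|B| B-unique G = record
    { cyclic   = (≢[]-resp-length (proj₁ (All.head cyclic)) |C|≡|B| , B-unique) ∷ All.tail cyclic
    ; distinct = Distinct⇒distinct (All.map (Distinct-respects {C = C} {D = B} C~B |C|≡|B|) (AllPairs.head ds)
                                    ∷ AllPairs.tail ds)
    ; F1       = f1
    ; F2       = λ i j i≢j no-ij (i⇝j , j⇝i) →
                   F2 i j i≢j (no-ij ∘ toB {i} {j}) (back {i} {j} i⇝j , back {j} {i} j⇝i)
    ; F3       = λ a → trans (sym (count-head-cong (a ∈?_) {x = C} {y = B} R (SameCycle-∈ {C = C} {D = B} C~B)
                                    (SameCycle-∈ {C = B} {D = C} (SameCycle-sym {C = C} {D = B} C~B)))) (F3 a)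
    ; F4       = λ a b a≢b → subst (_≤ 2) (cong₂ _+_ (edge-count a b) (edge-count b a)) (F4 a b a≢b)
    }
    where
    open IsGSP G
    ds : AllPairs Distinct (C ∷ R)
    ds = IsGSP⇒Distinct G
    edge-count : ∀ a b → mapCount a b (C ∷ R) ≡ mapCount a b (B ∷ R)
    edge-count a b =
      count-head-cong (edge? a b) {x = C} {y = B} R (Equivalence.to (C~B a b)) (Equivalence.from (C~B a b))
    toB : ∀ {i j} → Any (SameCycle (transp i j)) (C ∷ R) → Any (SameCycle (transp i j)) (B ∷ R)
    toB {i} {j} (here t~C) = here (SameCycle-trans {C = transp i j} {D = C} {E = B} t~C C~B)
    toB (there t∈R) = there t∈R
    back : ∀ {i j} → Accepts (B ∷ R) i j → Accepts (C ∷ R) i j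
    back {i} (_ , d , here refl , di , j≻d) = C , d , here refl , Equivalence.from (C~B d i) di , j≻d
    back (D , d , there D∈R , di , j≻d) = D , d , there D∈R , di , j≻d
    f1 : ∀ D → D ∈ B ∷ R → ∀ a b d → Maps D a b → Maps D d a → b ⪰[ a ] d
    f1 _ (here refl) a b d ab da =
      F1 C (here refl) a b d (Equivalence.from (C~B a b) ab) (Equivalence.from (C~B d a) da)
    f1 D (there D∈R) = F1 D (there D∈R)

IsGSP-rotateToFront : ∀ {n} (P : Preferences n) {c Π} → IsGSP P c Π → ∀ p (j : Fin (length (lookup Π p))) →
                      IsGSP P c (rotateAt (lookup Π p) j ∷ removeAt Π p)
IsGSP-rotateToFront {n} P {Π = Π} G p j =
  IsGSP-replaceHead P (SameCycle-rotateAt C j) (sym (↭-length (rotateAt-↭ C j)))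
    (↭ₛ.Unique-resp-↭ (≡.setoid (Fin n)) (↭⇒↭ₛ (↭-sym (rotateAt-↭ C j))) C-unique)
    (IsGSP-↭ P (↭-sym (lookup∷removeAt-↭ Π p)) G)
  where
  C : Cycle n
  C = lookup Π p
  C-unique : Unique C
  C-unique = proj₂ (All.lookup (IsGSP.cyclic G) (∈-lookup p))

data EvenLength {A : Set} : List A → Set where
  []    : EvenLength []
  2+    : ∀ {x y l} → EvenLength l → EvenLength (x ∷ y ∷ l)

module _ {A : Set} where

  EvenLength-odd-tail : ∀ {x : A} l → length (x ∷ l) % 2 ≡ 1 → EvenLength l
  EvenLength-odd-tail []          _    = []
  EvenLength-odd-tail {x} (y ∷ z ∷ l) odd = 2+ (EvenLength-odd-tail {x = x} l odd)

  EvenLength-wrap : ∀ {l : List A} → EvenLength l → ∀ x z → EvenLength (x ∷ l ++ [ z ])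
  EvenLength-wrap []      x z = 2+ []
  EvenLength-wrap (2+ {y = w} ev) x z = 2+ (EvenLength-wrap ev w z)

  Linked-++⁻ˡ : ∀ {R : A → A → Set} l m → Linked R (l ++ m) → Linked R l
  Linked-++⁻ˡ []          m _          = []
  Linked-++⁻ˡ (x ∷ [])    m _          = [-]
  Linked-++⁻ˡ (x ∷ y ∷ l) m (r ∷ rs) = r ∷ Linked-++⁻ˡ (y ∷ l) m rs

module _ {n : ℕ} where

  transp-Maps : ∀ {x y a b : Fin n} → Maps (transp x y) a b → (a ≡ x × b ≡ y) ⊎ (a ≡ y × b ≡ x)
  transp-Maps (here refl)         = inj₁ (refl , refl)
  transp-Maps (there (here refl)) = inj₂ (refl , refl)

  transp-Maps-swap : ∀ {x y a b : Fin n} → Maps (transp x y) a b → Maps (transp x y) b a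
  transp-Maps-swap (here refl)         = there (here refl)
  transp-Maps-swap (there (here refl)) = here refl

  transp-succ≡pred : ∀ {x y a b d : Fin n} → Maps (transp x y) a b → Maps (transp x y) d a → b ≡ d
  transp-succ≡pred (here refl)         (here refl)         = refl
  transp-succ≡pred (here refl)         (there (here refl)) = refl
  transp-succ≡pred (there (here refl)) (here refl)         = refl
  transp-succ≡pred (there (here refl)) (there (here refl)) = refl

  transp-cyclic : ∀ {x y : Fin n} → x ≢ y → IsCyclicPerm (transp x y)
  transp-cyclic x≢y = (λ ()) , (x≢y ∷ []) ∷ [] ∷ []

  SameCycle-transp : ∀ {x y : Fin n} {C} → SameCycle (transp x y) C → Maps C x y × Maps C y x
  SameCycle-transp {x} {y} t~C = Equivalence.to (t~C x y) (here refl) , Equivalence.to (t~C y x) (there (here refl))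

  transp-absent : ∀ {x y : Fin n} {Π} → (∀ {C} → C ∈ Π → Maps C x y → Maps C y x → ⊥) →
                  ¬ Any (SameCycle (transp x y)) Π
  transp-absent no-2-cycle t∈Π with find t∈Π
  ... | C , C∈Π , t~C with SameCycle-transp {C = C} t~C
  ...   | xy , yx = no-2-cycle C∈Π xy yx

  pairUp-transp : ∀ {R : Fin n → Fin n → Set} {M} → Linked R M →
                  ∀ {T} → T ∈ pairUp M → ∃[ x ] ∃[ y ] (T ≡ transp x y × R x y)
  pairUp-transp (r ∷ _)  (here refl) = _ , _ , refl , r
  pairUp-transp {M = _ ∷ _ ∷ M} (_ ∷ rs) (there T∈) = pairUp-transp {M = M} (Linked.tail rs) T∈

  pairUp-Maps⇒∈ : ∀ (M : List (Fin n)) {T a b} → T ∈ pairUp M → Maps T a b → a ∈ M × b ∈ M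
  pairUp-Maps⇒∈ (x ∷ y ∷ M) (here refl) ab with transp-Maps ab
  ... | inj₁ (refl , refl) = here refl , there (here refl)
  ... | inj₂ (refl , refl) = there (here refl) , here refl
  pairUp-Maps⇒∈ (x ∷ y ∷ M) (there T∈) ab with pairUp-Maps⇒∈ M T∈ ab
  ... | a∈ , b∈ = there (there a∈) , there (there b∈)

  EdgeDisjoint : Cycle n → Cycle n → Set
  EdgeDisjoint C D = ∀ {a b} → Maps C a b → Maps D a b → ⊥

  transp-EdgeDisjoint : ∀ {x y z : Fin n} M → z ∈ transp x y → z ∉ M → All (EdgeDisjoint (transp x y)) (pairUp M)
  transp-EdgeDisjoint M z∈xy z∉M = All.tabulate λ T∈ ab∈xy ab∈T → z∉M (endpoint z∈xy ab∈xy (pairUp-Maps⇒∈ M T∈ ab∈T))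
    where
    endpoint : ∀ {x y z a b} → z ∈ transp x y → Maps (transp x y) a b → a ∈ M × b ∈ M → z ∈ M
    endpoint (here refl)         (here refl)         (a∈ , _) = a∈
    endpoint (here refl)         (there (here refl)) (_ , b∈) = b∈
    endpoint (there (here refl)) (here refl)         (_ , b∈) = b∈
    endpoint (there (here refl)) (there (here refl)) (a∈ , _) = a∈

  pairUp-EdgeDisjoint : ∀ {M} → Unique M → AllPairs EdgeDisjoint (pairUp M)
  pairUp-EdgeDisjoint {[]}        _ = []
  pairUp-EdgeDisjoint {x ∷ []}    _ = []
  pairUp-EdgeDisjoint {x ∷ y ∷ M} ((_ ∷ x∉M) ∷ _ ∷ M-unique) =
    transp-EdgeDisjoint {x} {y} M (here refl) (λ x∈M → All.lookup x∉M x∈M refl) ∷ pairUp-EdgeDisjoint M-unique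

  pairUp-wrap-EdgeDisjoint : ∀ {x : Fin n} {l} → Unique (x ∷ l) → 1 ≤ length l →
                             AllPairs EdgeDisjoint (pairUp (x ∷ l ++ [ x ]))
  pairUp-wrap-EdgeDisjoint {x} {y ∷ l} ((x≢y ∷ x∉l) ∷ y∉l ∷ l-unique) _ =
    transp-EdgeDisjoint {x} {y} (l ++ [ x ]) (there (here refl)) y∉l++x
    ∷ pairUp-EdgeDisjoint (↭ₛ.Unique-resp-↭ (≡.setoid (Fin n)) (↭⇒↭ₛ (++-comm [ x ] l))
                                             (x∉l ∷ l-unique))
    where
    y∉l++x : y ∉ l ++ [ x ]
    y∉l++x y∈ with ∈-++⁻ l y∈
    ... | inj₁ y∈l        = All.lookup y∉l y∈l refl
    ... | inj₂ (here y≡x) = x≢y (sym y≡x)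

  some-edge : ∀ {C : Cycle n} → 1 ≤ length C → ∃[ a ] ∃[ b ] Maps C a b
  some-edge {c ∷ _} _ = let b , cb = successor (here refl) in c , b , cb

  EdgeDisjoint⇒Distinct : ∀ {C D : Cycle n} → EdgeDisjoint C D → Distinct C D
  EdgeDisjoint⇒Distinct {C} {D} C⊥D = distinguish
    (λ 2≤|C| C~D → let a , b , ab = some-edge {C} (≤-trans (n≤1+n 1) 2≤|C|)
                   in C⊥D ab (Equivalence.to (C~D a b) ab))
    (λ 2≤|D| D~C → let a , b , ab = some-edge {D} (≤-trans (n≤1+n 1) 2≤|D|)
                   in C⊥D (Equivalence.to (D~C a b) ab) ab)

  count-∈-unique : ∀ {a : Fin n} {C} → Unique C → a ∈ C → count (a ≟ᶠ_) C ≡ 1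
  count-∈-unique {a} {_ ∷ C} (a∉C ∷ _) (here refl) =
    trans (count-accept (a ≟ᶠ_) C refl) (cong suc (count≡0 (a ≟ᶠ_) C λ x∈C a≡x → All.lookup a∉C x∈C a≡x))
  count-∈-unique {a} {x ∷ C} (x∉C ∷ C-unique) (there a∈C) =
    trans (count-reject (a ≟ᶠ_) C λ { refl → All.lookup x∉C a∈C refl }) (count-∈-unique C-unique a∈C)

  count-∉ : ∀ {a : Fin n} C → a ∉ C → count (a ≟ᶠ_) C ≡ 0
  count-∉ {a} C a∉C = count≡0 (a ≟ᶠ_) C λ { x∈C refl → a∉C x∈C }

  occ-∷ : ∀ (a : Fin n) {C} R → Unique C → occ a (C ∷ R) ≡ count (a ≟ᶠ_) C + occ a R
  occ-∷ a {C} R C-unique with a ∈? C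
  ... | yes a∈C = cong (_+ occ a R) (sym (count-∈-unique C-unique a∈C))
  ... | no  a∉C = cong (_+ occ a R) (sym (count-∉ C a∉C))

  occ-pairUp : ∀ (a : Fin n) {M} → EvenLength M → Linked _≢_ M → occ a (pairUp M) ≡ count (a ≟ᶠ_) M
  occ-pairUp a []               _          = refl
  occ-pairUp a (2+ {x} {y} {M} ev) (x≢y ∷ rs) = begin
    occ a (transp x y ∷ pairUp M)                  ≡⟨ occ-∷ a (pairUp M) (proj₂ (transp-cyclic x≢y)) ⟩
    count (a ≟ᶠ_) (x ∷ y ∷ []) + occ a (pairUp M)  ≡⟨ cong (count (a ≟ᶠ_) (x ∷ y ∷ []) +_)
                                                           (occ-pairUp a ev (Linked.tail rs)) ⟩
    count (a ≟ᶠ_) (x ∷ y ∷ []) + count (a ≟ᶠ_) M   ≡⟨ count-++ (a ≟ᶠ_) (x ∷ y ∷ []) M ⟨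
    count (a ≟ᶠ_) (x ∷ y ∷ M)                      ∎
    where open ≡-Reasoning

  adjustCap-self : ∀ (c : Fin n → ℕ) a f → adjustCap c a f a ≡ f (c a)
  adjustCap-self c a f with a ≟ᶠ a
  ... | yes _   = refl
  ... | no  a≢a = ⊥-elim (a≢a refl)

  adjustCap-other : ∀ (c : Fin n → ℕ) {a} f {l} → l ≢ a → adjustCap c a f l ≡ c l
  adjustCap-other c {a} f {l} l≢a with l ≟ᶠ a
  ... | yes l≡a = ⊥-elim (l≢a l≡a)
  ... | no  _   = refl

-- Splitting an odd cycle

module OddCycleSplit {n : ℕ} (Pr : Preferences n) {c : Fin n → ℕ} {x₀ : Fin n} {t : List (Fin n)}
                     {R : Partition n} (G : IsGSP Pr c ((x₀ ∷ t) ∷ R))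
                     (3≤|B| : 3 ≤ length (x₀ ∷ t)) (|B|-odd : length (x₀ ∷ t) % 2 ≡ 1) where
  open Preferences Pr
  open IsGSP G
  B : Cycle n
  B = x₀ ∷ t

  B-unique : Unique B
  B-unique = proj₂ (All.head cyclic)

  R-unique : ∀ {C} → C ∈ R → Unique C
  R-unique C∈R = proj₂ (All.lookup (All.tail cyclic) C∈R)

  B-no-2-cycle : ∀ {x y} → Maps B x y → Maps B y x → ⊥
  B-no-2-cycle = no-2-cycle B-unique 3≤|B|

  B-edge-irreflexive : ∀ {x y} → Maps B x y → x ≢ y
  B-edge-irreflexive xy refl = B-no-2-cycle xy xy

  F4-excess : ∀ {u v} → u ≢ v → 2 ≤ mapCount u v (B ∷ R) → 1 ≤ mapCount v u (B ∷ R) → ⊥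
  F4-excess {u} {v} u≢v 2≤uv 1≤vu = 1+n≰n (≤-trans (+-mono-≤ 2≤uv 1≤vu) (F4 u v u≢v))

  edge-count≥1 : ∀ {u v C} → C ∈ B ∷ R → Maps C u v → 1 ≤ mapCount u v (B ∷ R)
  edge-count≥1 {u} {v} = count≥1 (edge? u v)

  edge-count≥2-B : ∀ {u v C} → Maps B u v → C ∈ R → Maps C u v → 2 ≤ mapCount u v (B ∷ R)
  edge-count≥2-B {u} {v} = count≥2-∷ (edge? u v) R

  edge-count≥2-R : ∀ {u v C D} → C ∈ R → D ∈ R → C ≢ D → Maps C u v → Maps D u v → 2 ≤ mapCount u v (B ∷ R)
  edge-count≥2-R {u} {v} C∈R D∈R C≢D uv uv′ =
    ≤-trans (count≥2 (edge? u v) C∈R D∈R C≢D uv uv′) (count-≤-∷ (edge? u v) B R)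

  B-edge-unpaired : ∀ {x y C} → Maps B x y → C ∈ B ∷ R → Maps C x y → Maps C y x → ⊥
  B-edge-unpaired xy (here refl) _  yx = B-no-2-cycle xy yx
  B-edge-unpaired xy (there C∈R) xy′ yx =
    F4-excess (B-edge-irreflexive xy) (edge-count≥2-B xy C∈R xy′) (edge-count≥1 (there C∈R) yx)

  strictly-preferred : ∀ {C x y w} → C ∈ B ∷ R → Maps C x y → Maps C w x → y ≢ w → y ≻[ x ] w
  strictly-preferred {C} {x} {y} {w} C∈ xy wx y≢w with F1 C C∈ x y w xy wx
  ... | inj₁ y≻w = y≻w
  ... | inj₂ y≡w = ⊥-elim (y≢w y≡w)

  B-pred-worse : ∀ {x y w} → Maps B x y → Maps B w x → y ≻[ x ] w
  B-pred-worse xy wx = strictly-preferred (here refl) xy wx λ { refl → B-no-2-cycle xy wx }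

  no-blocking-pair : ∀ {x y} → x ≢ y → ¬ Any (SameCycle (transp x y)) (B ∷ R) →
                     Accepts Pr (B ∷ R) x y → Accepts Pr (B ∷ R) y x → ⊥
  no-blocking-pair {x} {y} x≢y no-xy x⇝y y⇝x = F2 x y x≢y no-xy (x⇝y , y⇝x)

  B-edge-not-reversed : ∀ {x y C} → Maps B x y → C ∈ R → ¬ Maps C y x
  B-edge-not-reversed {x} {y} {C} xy C∈R yx
    with predecessor {C = B} (Maps⇒∈ˡ xy) | predecessor {C = C} (Maps⇒∈ˡ yx)
  ... | w , wx | v , vy =
    no-blocking-pair (B-edge-irreflexive xy) (transp-absent (B-edge-unpaired xy))
      (B , w , here refl , wx , B-pred-worse xy wx)
      (C , v , there C∈R , vy ,
       strictly-preferred (there C∈R) yx vy λ { refl → B-edge-unpaired xy (there C∈R) vy yx })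

  shared-edge-transp-absent : ∀ {a b v C} → C ∈ R → Maps B a b → Maps C a b → Maps C v a →
                              ¬ Any (SameCycle (transp a v)) (B ∷ R)
  shared-edge-transp-absent {a} {b} {v} {C} C∈R ab ab′ va = transp-absent unpaired
    where
    unpaired : ∀ {D} → D ∈ B ∷ R → Maps D a v → Maps D v a → ⊥
    unpaired (here refl) av va″ = B-no-2-cycle av va″
    unpaired {D} (there D∈R) av va″ with v ≟ᶠ b
    ... | yes refl = B-edge-unpaired ab (there D∈R) av va″
    ... | no v≢b   = F4-excess (λ { refl → v≢b (Maps-functional (R-unique C∈R) va ab′) })
                        (edge-count≥2-R C∈R D∈R C≢D va va″) (edge-count≥1 (there D∈R) av)
      where
      C≢D : C ≢ D
      C≢D refl = v≢b (Maps-functional (R-unique C∈R) av ab′)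

  -- Otherwise a has distinct predecessors w (in B) and v (in C), and whichever of them a prefers
  -- forms a blocking pair with a.
  shared-edge-backwards : ∀ {a b w C} → C ∈ R → Maps B a b → Maps C a b → Maps B w a → Maps C w a
  shared-edge-backwards {a} {b} {w} {C} C∈R ab ab′ wa with predecessor {C = C} (Maps⇒∈ˡ ab′)
  ... | v , va with w ≟ᶠ v
  ...   | yes refl = va
  ...   | no w≢v with IsStrictTotalOrder.compare (isSTO a) w v
  ...     | tri≈ _ w≡v _ = ⊥-elim (w≢v w≡v)
  ...     | tri< w≻v _ _ with predecessor {C = B} (Maps⇒∈ˡ wa)
  ...       | u , uw = ⊥-elim (no-blocking-pair (λ { refl → B-edge-irreflexive wa refl })
                               (transp-absent λ D∈ aw wa′ → B-edge-unpaired wa D∈ wa′ aw)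
                               (C , v , there C∈R , va , w≻v) (B , u , here refl , uw , B-pred-worse wa uw))
  shared-edge-backwards {a} {b} {w} {C} C∈R ab ab′ wa | v , va | no w≢v | tri> _ _ v≻w
    with predecessor {C = C} (Maps⇒∈ˡ va)
  ... | u , uv = ⊥-elim (no-blocking-pair a≢v (shared-edge-transp-absent C∈R ab ab′ va)
                          (B , w , here refl , wa , v≻w) (C , u , there C∈R , uv , a≻u))
    where
    a≢v : a ≢ v
    a≢v refl = B-edge-irreflexive ab (Maps-functional (R-unique C∈R) va ab′)
    a≻u : a ≻[ v ] u
    a≻u = strictly-preferred (there C∈R) va uv λ { refl → B-edge-unpaired ab (there C∈R) ab′
            (subst (λ z → Maps C z a) (Maps-functional (R-unique C∈R) uv ab′) va) }

  -- By shared-edge-backwards C would contain every edge of B, i.e. be the same cycle as B.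
  B-edge-not-in-R : ∀ {x y C} → Maps B x y → C ∈ R → ¬ Maps C x y
  B-edge-not-in-R {x} {y} {C} xy C∈R xy′ =
    Distinct.distinctˡ (All.lookup (AllPairs.head (IsGSP⇒Distinct Pr G)) C∈R) (≤-trans (n≤1+n 2) 3≤|B|) B~C
    where
    C-unique : Unique C
    C-unique = R-unique C∈R
    FollowsB : Fin n → Set
    FollowsB a = ∀ {b} → Maps B a b → Maps C a b
    follows : ∀ {a} → a ∈ B → FollowsB a
    follows a∈B = Maps-backpropagate FollowsB step a∈B (Maps⇒∈ˡ xy) x-follows
      where
      x-follows : FollowsB x
      x-follows xb = subst (Maps C x) (Maps-functional B-unique xy xb) xy′
      step : ∀ {w a} → Maps B w a → FollowsB a → FollowsB w
      step wa a-follows wb with successor (Maps⇒∈ʳ wa)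
      ... | _ , ab = subst (Maps C _) (Maps-functional B-unique wa wb)
                           (shared-edge-backwards C∈R ab (a-follows ab) wa)
    C-edge-in-B : ∀ {a b} → a ∈ B → Maps C a b → Maps B a b
    C-edge-in-B a∈B ab with successor a∈B
    ... | _ , ab′ = subst (Maps B _) (Maps-functional C-unique (follows a∈B ab′) ab) ab′
    C⊆B : ∀ {a} → a ∈ C → a ∈ B
    C⊆B a∈C = Maps-propagate (_∈ B) (λ ab a∈B → Maps⇒∈ʳ (C-edge-in-B a∈B ab)) (Maps⇒∈ˡ xy′) a∈C (Maps⇒∈ˡ xy)
    B~C : SameCycle B C
    B~C a b = mk⇔ (λ ab → follows (Maps⇒∈ˡ ab) ab) (λ ab → C-edge-in-B (C⊆B (Maps⇒∈ˡ ab)) ab)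

  B-edge-exclusive : ∀ {x y C} → Maps B x y → C ∈ R → ¬ (Maps C x y ⊎ Maps C y x)
  B-edge-exclusive xy C∈R (inj₁ xy′) = B-edge-not-in-R xy C∈R xy′
  B-edge-exclusive xy C∈R (inj₂ yx)  = B-edge-not-reversed xy C∈R yx

  module Split {M : List (Fin n)} {c′ : Fin n → ℕ} (M-edges : Linked (Maps B) M) (M-even : EvenLength M)
               (N-disjoint : AllPairs EdgeDisjoint (pairUp M))
               (capacity : ∀ a → count (a ≟ᶠ_) M + occ a R ≡ c′ a) where

    N : Partition n
    N = pairUp M

    N-transp : ∀ {T} → T ∈ N → ∃[ x ] ∃[ y ] (T ≡ transp x y × Maps B x y)
    N-transp = pairUp-transp M-edges

    N-cyclic : All IsCyclicPerm N
    N-cyclic = All.tabulate λ T∈N → case N-transp T∈N of λ where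
      (x , y , refl , xy) → transp-cyclic (B-edge-irreflexive xy)

    N-edge-fresh : ∀ {T a b C} → T ∈ N → Maps T a b → C ∈ R → ¬ (Maps C a b ⊎ Maps C b a)
    N-edge-fresh T∈N ab C∈R with N-transp T∈N
    ... | x , y , refl , xy with transp-Maps ab
    ...   | inj₁ (refl , refl) = B-edge-exclusive xy C∈R
    ...   | inj₂ (refl , refl) = B-edge-exclusive xy C∈R ∘ Data.Sum.swap

    R++N-Distinct : AllPairs Distinct (R ++ N)
    R++N-Distinct = AllPairs.++⁺ (AllPairs.tail (IsGSP⇒Distinct Pr G))
                                 (AllPairs.map EdgeDisjoint⇒Distinct N-disjoint)
                                 (All.tabulate λ C∈R → All.tabulate (R-N-Distinct C∈R))
      where
      R-N-Distinct : ∀ {C} → C ∈ R → ∀ {T} → T ∈ N → Distinct C T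
      R-N-Distinct C∈R T∈N with N-transp T∈N
      ... | x , y , refl , xy = distinguish
        (λ _ C~T → B-edge-not-in-R xy C∈R (Equivalence.from (C~T x y) (here refl)))
        (λ _ T~C → B-edge-not-in-R xy C∈R (Equivalence.to (T~C x y) (here refl)))

    R++N-F1 : ∀ C → C ∈ R ++ N → ∀ a b d → Maps C a b → Maps C d a → b ⪰[ a ] d
    R++N-F1 C C∈ a b d ab da with ∈-++⁻ R C∈
    ... | inj₁ C∈R = F1 C (there C∈R) a b d ab da
    ... | inj₂ C∈N with N-transp C∈N
    ...   | _ , _ , refl , _ = inj₂ (transp-succ≡pred ab da)

    -- In the transposition (x y) cut from the B-edge x → y, y keeps its predecessor x, while x gets
    -- its B-successor y, which by (F1) it likes at least as much as its B-predecessor.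
    predecessor-no-worse : ∀ {C d i} → C ∈ R ++ N → Maps C d i →
                           ∃[ C′ ] ∃[ d′ ] (C′ ∈ B ∷ R × Maps C′ d′ i × d ⪰[ i ] d′)
    predecessor-no-worse {C} {d} C∈ di with ∈-++⁻ R C∈
    ... | inj₁ C∈R = C , d , there C∈R , di , inj₂ refl
    ... | inj₂ C∈N with N-transp C∈N
    ...   | x , y , refl , xy with transp-Maps di
    ...     | inj₁ (refl , refl) = B , d , here refl , xy , inj₂ refl
    ...     | inj₂ (refl , refl) with predecessor {C = B} (Maps⇒∈ˡ xy)
    ...       | w , wx = B , w , here refl , wx , F1 B (here refl) x y w xy wx

    Accepts-R++N⇒B∷R : ∀ {i j} → Accepts Pr (R ++ N) i j → Accepts Pr (B ∷ R) i j
    Accepts-R++N⇒B∷R (C , d , C∈ , di , j≻d) with predecessor-no-worse C∈ di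
    ... | C′ , d′ , C′∈ , d′i , d⪰d′ = C′ , d′ , C′∈ , d′i , ≻-⪰-trans Pr j≻d d⪰d′

    R++N-F2 : ∀ i j → i ≢ j → ¬ Any (SameCycle (transp i j)) (R ++ N) →
              ¬ (Accepts Pr (R ++ N) i j × Accepts Pr (R ++ N) j i)
    R++N-F2 i j i≢j no-ij (i⇝j , j⇝i) =
      no-blocking-pair i≢j no-ij′ (Accepts-R++N⇒B∷R i⇝j) (Accepts-R++N⇒B∷R j⇝i)
      where
      no-ij′ : ¬ Any (SameCycle (transp i j)) (B ∷ R)
      no-ij′ (here t~B)  = let ij , ji = SameCycle-transp {C = B} t~B in B-no-2-cycle ij ji
      no-ij′ (there t∈R) = no-ij (Any.++⁺ˡ t∈R)

    R++N-F3 : ∀ a → occ a (R ++ N) ≡ c′ a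
    R++N-F3 a = begin
      occ a (R ++ N)                ≡⟨ count-++ (a ∈?_) R N ⟩
      occ a R + occ a N             ≡⟨ cong (occ a R +_)
                                              (occ-pairUp a M-even (Linked.map B-edge-irreflexive M-edges)) ⟩
      occ a R + count (a ≟ᶠ_) M     ≡⟨ +-comm (occ a R) _ ⟩
      count (a ≟ᶠ_) M + occ a R     ≡⟨ capacity a ⟩
      c′ a                          ∎
      where open ≡-Reasoning

    edge-count≤1 : ∀ {u v} → (∀ {C} → C ∈ R → ¬ Maps C u v) → mapCount u v (R ++ N) ≤ 1
    edge-count≤1 {u} {v} not-in-R = begin
      mapCount u v (R ++ N)            ≡⟨ count-++ (edge? u v) R N ⟩
      mapCount u v R + mapCount u v N  ≡⟨ cong (_+ mapCount u v N) (count≡0 (edge? u v) R not-in-R) ⟩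
      mapCount u v N                   ≤⟨ count≤1 (edge? u v) N-disjoint (λ uv uv′ T⊥T′ → T⊥T′ uv uv′) ⟩
      1                                ∎
      where open ≤-Reasoning

    edge-count-from-R : ∀ {u v} → (∀ {T} → T ∈ N → ¬ Maps T u v) → mapCount u v (R ++ N) ≤ mapCount u v (B ∷ R)
    edge-count-from-R {u} {v} not-in-N = begin
      mapCount u v (R ++ N)            ≡⟨ count-++ (edge? u v) R N ⟩
      mapCount u v R + mapCount u v N  ≡⟨ cong (mapCount u v R +_) (count≡0 (edge? u v) N not-in-N) ⟩
      mapCount u v R + 0               ≡⟨ +-identityʳ _ ⟩
      mapCount u v R                   ≤⟨ count-≤-∷ (edge? u v) B R ⟩
      mapCount u v (B ∷ R)             ∎
      where open ≤-Reasoning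

    R++N-F4 : ∀ a b → a ≢ b → mapCount a b (R ++ N) + mapCount b a (R ++ N) ≤ 2
    R++N-F4 a b a≢b with any? (edge? a b) N
    ... | yes ab∈N = let T , T∈N , ab = find ab∈N in
      +-mono-≤ (edge-count≤1 λ C∈R → N-edge-fresh T∈N ab C∈R ∘ inj₁)
               (edge-count≤1 λ C∈R → N-edge-fresh T∈N ab C∈R ∘ inj₂)
    ... | no ab∉N = ≤-trans
      (+-mono-≤ (edge-count-from-R λ T∈N ab → ab∉N (lose T∈N ab))
                (edge-count-from-R λ T∈N ba → ab∉N (lose T∈N (transp-Maps-swap′ T∈N ba))))
      (F4 a b a≢b)
      where
      transp-Maps-swap′ : ∀ {T} → T ∈ N → Maps T b a → Maps T a b
      transp-Maps-swap′ T∈N ba with N-transp T∈N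
      ... | _ , _ , refl , _ = transp-Maps-swap ba

    IsGSP-R++N : IsGSP Pr c′ (R ++ N)
    IsGSP-R++N = record
      { cyclic   = All.++⁺ (All.tail cyclic) N-cyclic
      ; distinct = Distinct⇒distinct Pr R++N-Distinct
      ; F1       = R++N-F1
      ; F2       = R++N-F2
      ; F3       = R++N-F3
      ; F4       = R++N-F4
      }

  capacity-B : ∀ a → c a ≡ count (a ≟ᶠ_) B + occ a R
  capacity-B a = trans (sym (F3 a)) (occ-∷ a R B-unique)

  capacity-without-x₀ : ∀ a → count (a ≟ᶠ_) t + occ a R ≡ adjustCap c x₀ (λ x → x ∸ 1) a
  capacity-without-x₀ a = by-cases (a ≟ᶠ x₀)
    where
    open ≡-Reasoning
    by-cases : Dec (a ≡ x₀) → count (a ≟ᶠ_) t + occ a R ≡ adjustCap c x₀ (λ x → x ∸ 1) a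
    by-cases (yes refl) = sym (begin
      adjustCap c a (λ x → x ∸ 1) a        ≡⟨ adjustCap-self c a (λ x → x ∸ 1) ⟩
      c a ∸ 1                              ≡⟨ cong (_∸ 1) (capacity-B a) ⟩
      (count (a ≟ᶠ_) B + occ a R) ∸ 1      ≡⟨ cong (λ k → (k + occ a R) ∸ 1) (count-accept (a ≟ᶠ_) t refl) ⟩
      count (a ≟ᶠ_) t + occ a R            ∎)
    by-cases (no a≢x₀) = begin
      count (a ≟ᶠ_) t + occ a R            ≡⟨ cong (_+ occ a R) (count-reject (a ≟ᶠ_) t a≢x₀) ⟨
      count (a ≟ᶠ_) B + occ a R            ≡⟨ capacity-B a ⟨
      c a                                  ≡⟨ adjustCap-other c (λ x → x ∸ 1) a≢x₀ ⟨
      adjustCap c x₀ (λ x → x ∸ 1) a       ∎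

  capacity-with-x₀-twice : ∀ a → count (a ≟ᶠ_) (B ++ [ x₀ ]) + occ a R ≡ adjustCap c x₀ suc a
  capacity-with-x₀-twice a = by-cases (a ≟ᶠ x₀)
    where
    open ≡-Reasoning
    by-cases : Dec (a ≡ x₀) → count (a ≟ᶠ_) (B ++ [ x₀ ]) + occ a R ≡ adjustCap c x₀ suc a
    by-cases (yes refl) = begin
      count (a ≟ᶠ_) (B ++ [ a ]) + occ a R             ≡⟨ cong (_+ occ a R) (count-++ (a ≟ᶠ_) B [ a ]) ⟩
      count (a ≟ᶠ_) B + count (a ≟ᶠ_) [ a ] + occ a R  ≡⟨ cong (λ k → count (a ≟ᶠ_) B + k + occ a R)
                                                               (count-accept (a ≟ᶠ_) [] refl) ⟩
      count (a ≟ᶠ_) B + 1 + occ a R                    ≡⟨ cong (_+ occ a R) (+-comm (count (a ≟ᶠ_) B) 1) ⟩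
      suc (count (a ≟ᶠ_) B + occ a R)                  ≡⟨ cong suc (capacity-B a) ⟨
      suc (c a)                                        ≡⟨ adjustCap-self c a suc ⟨
      adjustCap c a suc a                              ∎
    by-cases (no a≢x₀) = begin
      count (a ≟ᶠ_) (B ++ [ x₀ ]) + occ a R             ≡⟨ cong (_+ occ a R) (count-++ (a ≟ᶠ_) B [ x₀ ]) ⟩
      count (a ≟ᶠ_) B + count (a ≟ᶠ_) [ x₀ ] + occ a R  ≡⟨ cong (λ k → count (a ≟ᶠ_) B + k + occ a R)
                                                                (count-reject (a ≟ᶠ_) [] a≢x₀) ⟩
      count (a ≟ᶠ_) B + 0 + occ a R                     ≡⟨ cong (_+ occ a R) (+-identityʳ _) ⟩
      count (a ≟ᶠ_) B + occ a R                         ≡⟨ capacity-B a ⟨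
      c a                                               ≡⟨ adjustCap-other c suc a≢x₀ ⟨
      adjustCap c x₀ suc a                              ∎

  B-walk : Linked (Maps B) (B ++ [ x₀ ])
  B-walk = pathPairs-linked t

  IsGSP-without-x₀ : IsGSP Pr (adjustCap c x₀ (λ x → x ∸ 1)) (R ++ pairUp t)
  IsGSP-without-x₀ =
    Split.IsGSP-R++N (Linked-++⁻ˡ t [ x₀ ] (Linked.tail B-walk)) (EvenLength-odd-tail {x = x₀} t |B|-odd)
                     (pairUp-EdgeDisjoint (AllPairs.tail B-unique)) capacity-without-x₀

  IsGSP-with-x₀-twice : IsGSP Pr (adjustCap c x₀ suc) (R ++ pairUp (B ++ [ x₀ ]))
  IsGSP-with-x₀-twice =
    Split.IsGSP-R++N B-walk (EvenLength-wrap (EvenLength-odd-tail {x = x₀} t |B|-odd) x₀ x₀)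
                     (pairUp-wrap-EdgeDisjoint B-unique (≤-trans (n≤1+n 1) (≤-pred 3≤|B|)))
                     capacity-with-x₀-twice

lemma14 : ∀ {n : ℕ} (P : Preferences n) (c : Fin n → ℕ) → ValidCapacity n c →
          (Π : Partition n) → IsGSP P c Π →
          (p : Fin (length Π)) →
          let C = lookup Π p in
          3 ≤ length C → length C % 2 ≡ 1 →
          (j : Fin (length C)) →
          let aj = lookup C j
              B  = rotateAt C j
          in IsGSP P (adjustCap c aj (λ x → x ∸ 1)) (removeAt Π p ++ pairUp (drop 1 B))
           × IsGSP P (adjustCap c aj suc) (removeAt Π p ++ pairUp (B ++ take 1 B))
lemma14 P c _ Π G p 3≤|C| |C|-odd j
  with rotateAt (lookup Π p) j | rotateAt-lookup (lookup Π p) j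
     | IsGSP-rotateToFront P G p j | ↭-length (rotateAt-↭ (lookup Π p) j)
... | _ | refl | G′ | |B|≡|C| = IsGSP-without-x₀ , IsGSP-with-x₀-twice
  where open OddCycleSplit P G′ (subst (3 ≤_) (sym |B|≡|C|) 3≤|C|)
                                (subst (λ k → k % 2 ≡ 1) (sym |B|≡|C|) |C|-odd)
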